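{- For every integer $r \ge 2$ and every $\varepsilon > 0$ there exists $\eta_0 > 0$ such that for every $0 < \eta \le \eta_0$ there exists $n_0$ such that the following holds. Every edge-coloured graph $G$ on $n \ge n_0$ vertices with $\delta^c(G)\ge \left(1-\frac{1}{2(r-1)} + \varepsilon\right) n$ is $(1, \eta;K_r)$-closed.
   Context: An edge-coloured graph is a (finite, simple) graph together with an assignment of a colour to each edge; $\delta^c(G)$ is the minimum over vertices $v$ of the number of distinct colours on edges incident to $v$. A subgraph is rainbow if all its edges have distinct colours; a perfect rainbow-$K_r$-tiling of a graph is a set of vertex-disjoint rainbow copies of $K_r$ covering all its vertices. For $s \in \mathbb{N}$ and vertices $x,y$ of $G$ (with $|V(G)| = n$), a set $S \subseteq V(G)$ is an $(x,y;K_r)$-connector of length $s$ if $S \cap \{x,y\} = \emptyset$, $|S| = rs-1$, and both $G[S \cup \{x\}]$ and $G[S\cup\{y\}]$ contain perfect rainbow-$K_r$-tilings. Two vertices $x,y$ are $(s,\eta;K_r)$-close if there are at least $\eta n^{rs-1}$ $(x,y;K_r)$-connectors of length $s$ in $G$. $G$ is $(s,\eta;K_r)$-closed if every two vertices of $G$ are $(s,\eta;K_r)$-close. -}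

module Defs where

open import Data.Nat using (ℕ; zero; suc; _*_; _∸_; _^_)
open import Data.Bool using (Bool; true; false)
open import Data.Fin using (Fin)
open import Data.Fin.Subset using (Subset; _∈_; _∉_; _∪_; ⁅_⁆; ∣_∣)
open import Data.List using (List; length; map; filter; deduplicate; allFin)
open import Data.Product using (_×_; ∃)
open import Data.List.Relation.Unary.Any using (Any)
open import Data.List.Relation.Unary.All using (All)
open import Data.List.Relation.Unary.AllPairs using (AllPairs)
open import Data.List.Relation.Unary.Unique.Propositional using (Unique)
open import Data.Sum using (_⊎_)
open import Data.Empty using (⊥)
open import Data.Integer using (+_)
open import Data.Rational using (ℚ; _/_; 0ℚ) renaming (_*_ to _*ℚ_; _≤_ to _≤ℚ_)
open import Relation.Binary.PropositionalEquality using (_≡_; _≢_)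
open import Function.Bundles using (_⇔_)
import Data.Nat.Properties as ℕP

-- A finite simple edge-coloured graph on vertex set Fin n.
-- Colours are natural numbers (w.l.o.g. for a finite graph); the colour of
-- a non-edge is irrelevant.
record ECGraph (n : ℕ) : Set where
  field
    adj       : Fin n → Fin n → Bool
    adj-sym   : ∀ u v → adj u v ≡ adj v u
    adj-irr   : ∀ v → adj v v ≡ false
    col       : Fin n → Fin n → ℕ
    col-sym   : ∀ u v → col u v ≡ col v u

open ECGraph public

nbrs : ∀ {n} → ECGraph n → Fin n → List (Fin n)
nbrs {n} G v = filter (λ u → Data.Bool._≟_ (adj G v u) true) (allFin n)

colourDeg : ∀ {n} → ECGraph n → Fin n → ℕ
colourDeg G v = length (deduplicate ℕP._≟_ (map (col G v) (nbrs G v)))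

minColourDeg≥ : ∀ {n} → ECGraph n → ℚ → Set
minColourDeg≥ G d = ∀ v → d ≤ℚ (+ colourDeg G v / 1)

RainbowKr : ∀ {n} → ECGraph n → ℕ → Subset n → Set
RainbowKr G r K =
  (∣ K ∣ ≡ r) ×
  ((∀ u v → u ∈ K → v ∈ K → u ≢ v → adj G u v ≡ true) ×
   (∀ u v u' v' → u ∈ K → v ∈ K → u' ∈ K → v' ∈ K → u ≢ v → u' ≢ v' →
      col G u v ≡ col G u' v' → (u ≡ u' × v ≡ v') ⊎ (u ≡ v' × v ≡ u')))

Disjoint : ∀ {n} → Subset n → Subset n → Set
Disjoint A B = ∀ v → v ∈ A → v ∈ B → ⊥

HasPerfectRainbowTiling : ∀ {n} → ECGraph n → ℕ → Subset n → Set
HasPerfectRainbowTiling {n} G r T =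
  ∃ λ (Ks : List (Subset n)) →
    All (RainbowKr G r) Ks × AllPairs Disjoint Ks ×
    (∀ v → (v ∈ T) ⇔ Any (v ∈_) Ks)

Connector : ∀ {n} → ECGraph n → ℕ → ℕ → Fin n → Fin n → Subset n → Set
Connector G r s x y S =
  x ∉ S × y ∉ S × (∣ S ∣ ≡ r * s ∸ 1) ×
  HasPerfectRainbowTiling G r (S ∪ ⁅ x ⁆) × HasPerfectRainbowTiling G r (S ∪ ⁅ y ⁆)

Close : ∀ {n} → ECGraph n → ℕ → ℕ → ℚ → Fin n → Fin n → Set
Close {n} G r s η x y =
  ∃ λ (L : List (Subset n)) →
    Unique L × All (Connector G r s x y) L ×
    (η *ℚ (+ (n ^ (r * s ∸ 1)) / 1) ≤ℚ (+ length L / 1))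

Closed : ∀ {n} → ECGraph n → ℕ → ℕ → ℚ → Set
Closed G r s η = ∀ x y → Close G r s η x y

-- 1/(2(r-1)) for r ≥ 2 (value for r < 2 is irrelevant)
inv2rm1 : ℕ → ℚ
inv2rm1 zero = 0ℚ
inv2rm1 (suc zero) = 0ℚ
inv2rm1 (suc (suc k)) = + 1 / (2 * suc k)

-- Fix x, y and write r = K + 1.  Every vertex v chooses one neighbour of each colour at v,
-- except the (at most two) whose colour is that of vx or vy, so it fails to choose at most
-- n/(2K) − εn + 2 vertices.  Sequences v₁, …, v_K are built greedily: the next vertex must be
-- chosen by x, y and every earlier vᵢ and choose them back (a candidate), and none of its edges
-- to x, y, v₁, … may repeat a colour already present among these vertices.  Then {x, v₁, …, v_K}
-- and {y, v₁, …, v_K} span rainbow cliques.  By double counting and Markov's inequality a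
-- positive fraction of the candidates destroy at most n/K − Ω(n) other candidates, so after
-- fewer than K steps Ω(n) candidates remain, only O(1) of which clash.  This gives Ω(n^K)
-- sequences, and a K-set comes from at most K^K of them.

module Submission where

open import Defs
open import Data.Bool using (Bool; true; false; T; _∧_; _∨_; not; if_then_else_)
open import Data.Bool.ListAction using (any; all)
open import Data.Bool.Properties using (T-∧; T-∨; ∧-comm)
open import Data.Empty using (⊥-elim)
open import Data.Fin using (Fin)
open import Data.List using (List; []; _∷_; length; map; filter; filterᵇ; concatMap; allFin; deduplicate)
open import Data.List.Membership.Propositional using (_∈_; find)
open import Data.List.Membership.Propositional.Properties
  using (∈-filter⁻; ∈-filter⁺; ∈-map⁺; ∈-map⁻; ∈-concatMap⁺; ∈-concatMap⁻)
open import Data.List.Properties using (length-++; length-map; filter-notAll)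
open import Data.List.Relation.Unary.All as All using (All; []; _∷_)
import Data.List.Relation.Unary.All.Properties as All
open import Data.List.Relation.Unary.AllPairs using ([]; _∷_)
open import Data.List.Relation.Unary.Any as Any using (here; there)
open import Data.List.Relation.Unary.Unique.Propositional using (Unique)
open import Data.List.Relation.Unary.Unique.Propositional.Properties using (filter⁺)
open import Data.Nat using (ℕ)
open import Data.Product using (_×_; _,_; proj₁; proj₂; ∃)
open import Data.Sum using (_⊎_; inj₁; inj₂)
open import Function using (_∘_; id)
open import Function.Bundles using (Equivalence)
open import Relation.Binary.Definitions using (DecidableEquality)
open import Relation.Binary.PropositionalEquality
open import Relation.Nullary using (¬_; does; ¬?)
open import Relation.Nullary.Decidable using (T?; isYes; isNo; toWitness; fromWitness; toWitnessFalse)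
import Relation.Unary as U

T-∧⁻ : ∀ {a b} → T (a ∧ b) → T a × T b
T-∧⁻ = Equivalence.to T-∧

T-∧⁺ : ∀ {a b} → T a → T b → T (a ∧ b)
T-∧⁺ ta tb = Equivalence.from T-∧ (ta , tb)

T-not⇒¬T : ∀ {b} → T (not b) → ¬ T b
T-not⇒¬T {false} _ ()

module Counting where

  open import Data.Nat using (ℕ; zero; suc; _+_; _*_; _≤_; _<_; _<ᵇ_; _^_; z≤n; s≤s)
  open import Data.Nat.Properties
  open import Data.Nat.ListAction using (sum)
  open import Algebra.Properties.CommutativeSemigroup +-commutativeSemigroup using () renaming (interchange to +-interchange)

  private variable
    A B : Set

  countᵇ : (A → Bool) → List A → ℕ
  countᵇ p = length ∘ filterᵇ p

  ∑ : List A → (A → ℕ) → ℕ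
  ∑ xs f = sum (map f xs)

  syntax ∑ xs (λ a → e) = ∑[ a ← xs ] e

  countᵇ-mono : ∀ (p q : A → Bool) xs → (∀ {a} → a ∈ xs → T (p a) → T (q a)) →
                countᵇ p xs ≤ countᵇ q xs
  countᵇ-mono p q [] h = z≤n
  countᵇ-mono p q (a ∷ xs) h with p a | q a | h (here refl)
  ... | true  | true  | _   = s≤s (countᵇ-mono p q xs (h ∘ there))
  ... | true  | false | p⇒q = ⊥-elim (p⇒q _)
  ... | false | true  | _   = m≤n⇒m≤1+n (countᵇ-mono p q xs (h ∘ there))
  ... | false | false | _   = countᵇ-mono p q xs (h ∘ there)

  countᵇ-cong : ∀ (p q : A → Bool) xs → (∀ a → p a ≡ q a) → countᵇ p xs ≡ countᵇ q xs
  countᵇ-cong p q xs h = ≤-antisym (countᵇ-mono p q xs (λ {a} _ → subst T (h a)))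
                                   (countᵇ-mono q p xs (λ {a} _ → subst T (sym (h a))))

  countᵇ-split : ∀ (p q : A → Bool) xs →
                 countᵇ p xs ≡ countᵇ (λ a → p a ∧ q a) xs + countᵇ (λ a → p a ∧ not (q a)) xs
  countᵇ-split p q [] = refl
  countᵇ-split p q (a ∷ xs) with p a | q a
  ... | true  | true  = cong suc (countᵇ-split p q xs)
  ... | true  | false = trans (cong suc (countᵇ-split p q xs)) (sym (+-suc _ _))
  ... | false | _     = countᵇ-split p q xs

  countᵇ+countᵇ-not : ∀ (p : A → Bool) xs → countᵇ p xs + countᵇ (not ∘ p) xs ≡ length xs
  countᵇ+countᵇ-not p [] = refl
  countᵇ+countᵇ-not p (a ∷ xs) with p a
  ... | true  = cong suc (countᵇ+countᵇ-not p xs)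
  ... | false = trans (+-suc _ _) (cong suc (countᵇ+countᵇ-not p xs))

  countᵇ-∨ : ∀ (p q : A → Bool) xs → countᵇ (λ a → p a ∨ q a) xs ≤ countᵇ p xs + countᵇ q xs
  countᵇ-∨ p q [] = z≤n
  countᵇ-∨ p q (a ∷ xs) with p a | q a
  ... | true  | true  = s≤s (≤-trans (countᵇ-∨ p q xs) (≤-trans (n≤1+n _) (≤-reflexive (sym (+-suc _ _)))))
  ... | true  | false = s≤s (countᵇ-∨ p q xs)
  ... | false | true  = ≤-trans (s≤s (countᵇ-∨ p q xs)) (≤-reflexive (sym (+-suc _ _)))
  ... | false | false = countᵇ-∨ p q xs

  countᵇ-filterᵇ : ∀ (p q : A → Bool) xs → countᵇ q (filterᵇ p xs) ≡ countᵇ (λ a → p a ∧ q a) xs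
  countᵇ-filterᵇ p q [] = refl
  countᵇ-filterᵇ p q (a ∷ xs) with p a
  ... | false = countᵇ-filterᵇ p q xs
  ... | true with q a
  ...   | true  = cong suc (countᵇ-filterᵇ p q xs)
  ...   | false = countᵇ-filterᵇ p q xs

  countᵇ-∷ : ∀ (p : A → Bool) a xs → countᵇ p (a ∷ xs) ≡ (if p a then 1 else 0) + countᵇ p xs
  countᵇ-∷ p a xs with p a
  ... | true  = refl
  ... | false = refl

  countᵇ≡∑ : ∀ (p : A → Bool) xs → countᵇ p xs ≡ ∑[ a ← xs ] (if p a then 1 else 0)
  countᵇ≡∑ p [] = refl
  countᵇ≡∑ p (a ∷ xs) = trans (countᵇ-∷ p a xs) (cong (_ +_) (countᵇ≡∑ p xs))

  ∑-mono : ∀ (f g : A → ℕ) xs → (∀ {a} → a ∈ xs → f a ≤ g a) → ∑ xs f ≤ ∑ xs g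
  ∑-mono f g [] h = z≤n
  ∑-mono f g (a ∷ xs) h = +-mono-≤ (h (here refl)) (∑-mono f g xs (h ∘ there))

  ∑-cong : ∀ (f g : A → ℕ) xs → (∀ a → f a ≡ g a) → ∑ xs f ≡ ∑ xs g
  ∑-cong f g [] h = refl
  ∑-cong f g (a ∷ xs) h = cong₂ _+_ (h a) (∑-cong f g xs h)

  ∑-+ : ∀ (f g : A → ℕ) xs → ∑[ a ← xs ] (f a + g a) ≡ ∑ xs f + ∑ xs g
  ∑-+ f g [] = refl
  ∑-+ f g (a ∷ xs) = trans (cong (f a + g a +_) (∑-+ f g xs)) (+-interchange (f a) (g a) _ _)

  ∑-*ˡ : ∀ c (f : A → ℕ) xs → ∑[ a ← xs ] (c * f a) ≡ c * ∑ xs f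
  ∑-*ˡ c f [] = sym (*-zeroʳ c)
  ∑-*ˡ c f (a ∷ xs) = trans (cong (c * f a +_) (∑-*ˡ c f xs)) (sym (*-distribˡ-+ c (f a) _))

  ∑-const : ∀ c (xs : List A) → ∑[ _ ← xs ] c ≡ length xs * c
  ∑-const c [] = refl
  ∑-const c (a ∷ xs) = cong (c +_) (∑-const c xs)

  ∑-countᵇ-comm : ∀ (P : A → B → Bool) xs ys →
                  ∑[ a ← xs ] countᵇ (P a) ys ≡ ∑[ b ← ys ] countᵇ (λ a → P a b) xs
  ∑-countᵇ-comm P [] ys = sym (trans (∑-const 0 ys) (*-zeroʳ (length ys)))
  ∑-countᵇ-comm P (a ∷ xs) ys = begin
    countᵇ (P a) ys + ∑[ a′ ← xs ] countᵇ (P a′) ys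
      ≡⟨ cong₂ _+_ (countᵇ≡∑ (P a) ys) (∑-countᵇ-comm P xs ys) ⟩
    ∑[ b ← ys ] (if P a b then 1 else 0) + ∑[ b ← ys ] countᵇ (λ a′ → P a′ b) xs
      ≡⟨ ∑-+ (λ b → if P a b then 1 else 0) (λ b → countᵇ (λ a′ → P a′ b) xs) ys ⟨
    ∑[ b ← ys ] ((if P a b then 1 else 0) + countᵇ (λ a′ → P a′ b) xs)
      ≡⟨ ∑-cong _ _ ys (λ b → countᵇ-∷ (λ a′ → P a′ b) a xs) ⟨
    ∑[ b ← ys ] countᵇ (λ a′ → P a′ b) (a ∷ xs) ∎
    where open ≡-Reasoning

  markov : ∀ (f : A → ℕ) t xs → countᵇ (λ a → t <ᵇ f a) xs * suc t ≤ ∑ xs f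
  markov f t [] = z≤n
  markov f t (a ∷ xs) with t <ᵇ f a in t<f
  ... | false = ≤-trans (markov f t xs) (m≤n+m _ (f a))
  ... | true  = +-mono-≤ (<ᵇ⇒< t (f a) (subst T (sym t<f) _)) (markov f t xs)

  countᵇ-any : ∀ (P : B → A → Bool) bs xs →
               countᵇ (λ a → any (λ b → P b a) bs) xs ≤ ∑[ b ← bs ] countᵇ (P b) xs
  countᵇ-any P [] xs = ≤-reflexive (countᵇ-false xs)
    where countᵇ-false : ∀ (xs : List A) → countᵇ (λ _ → false) xs ≡ 0
          countᵇ-false []       = refl
          countᵇ-false (_ ∷ xs) = countᵇ-false xs
  countᵇ-any P (b ∷ bs) xs = ≤-trans (countᵇ-∨ (P b) _ xs) (+-monoʳ-≤ _ (countᵇ-any P bs xs))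

  countᵇ-any³ : ∀ (P : B → B → B → A → Bool) ks xs →
                (∀ {u} → u ∈ ks → ∀ a b → countᵇ (P u a b) xs ≤ 1) →
                countᵇ (λ v → any (λ u → any (λ a → any (λ b → P u a b v) ks) ks) ks) xs ≤ length ks ^ 3
  countᵇ-any³ P ks xs P≤1 = begin
    countᵇ (λ v → any (λ u → any (λ a → any (λ b → P u a b v) ks) ks) ks) xs
      ≤⟨ countᵇ-any _ ks xs ⟩
    ∑[ u ← ks ] countᵇ (λ v → any (λ a → any (λ b → P u a b v) ks) ks) xs
      ≤⟨ ∑-mono _ _ ks (λ _ → countᵇ-any _ ks xs) ⟩
    ∑[ u ← ks ] ∑[ a ← ks ] countᵇ (λ v → any (λ b → P u a b v) ks) xs
      ≤⟨ ∑-mono _ _ ks (λ _ → ∑-mono _ _ ks (λ _ → countᵇ-any _ ks xs)) ⟩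
    ∑[ u ← ks ] ∑[ a ← ks ] ∑[ b ← ks ] countᵇ (P u a b) xs
      ≤⟨ ∑-mono _ _ ks (λ u∈ → ∑-mono _ _ ks (λ {a} _ → ∑-mono _ _ ks (λ {b} _ → P≤1 u∈ a b))) ⟩
    ∑[ u ← ks ] ∑[ a ← ks ] ∑[ b ← ks ] 1
      ≡⟨ ∑-cong _ _ ks (λ _ → trans (∑-cong _ _ ks (λ _ → ∑-const 1 ks)) (∑-const _ ks)) ⟩
    ∑[ u ← ks ] (length ks * (length ks * 1))
      ≡⟨ ∑-const _ ks ⟩
    length ks ^ 3
      ∎
    where open ≤-Reasoning

  length-concatMap : ∀ (f : A → List B) xs → length (concatMap f xs) ≡ ∑[ a ← xs ] length (f a)
  length-concatMap f [] = refl
  length-concatMap f (a ∷ xs) = trans (length-++ (f a)) (cong (length (f a) +_) (length-concatMap f xs))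

  countᵇ-filterᵇ-≤ : ∀ (p q : A → Bool) xs → countᵇ q (filterᵇ p xs) ≤ countᵇ q xs
  countᵇ-filterᵇ-≤ p q xs = ≤-trans (≤-reflexive (countᵇ-filterᵇ p q xs))
                                    (countᵇ-mono _ q xs (λ _ → proj₂ ∘ T-∧⁻))

  countᵇ-≤1 : ∀ (p : A → Bool) {xs} → Unique xs →
              (∀ {a b} → a ∈ xs → b ∈ xs → T (p a) → T (p b) → a ≡ b) → countᵇ p xs ≤ 1
  countᵇ-≤1 p {xs} xs! p-unique = unique-singleton (filter⁺ (T? ∘ p) xs!) (∈-filter⁻ (T? ∘ p) {xs = xs})
    where
      unique-singleton : ∀ {ys} → Unique ys → (∀ {a} → a ∈ ys → a ∈ xs × T (p a)) → length ys ≤ 1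
      unique-singleton []                   _ = z≤n
      unique-singleton (_ ∷ [])             _ = s≤s z≤n
      unique-singleton ((a≢b ∷ _) ∷ _ ∷ _) ⊆p with ⊆p (here refl) | ⊆p (there (here refl))
      ... | a∈xs , pa | b∈xs , pb = ⊥-elim (a≢b (p-unique a∈xs b∈xs pa pb))

  unique-map⇒injective : ∀ (f : A → B) {xs} → Unique (map f xs) →
                         ∀ {a b} → a ∈ xs → b ∈ xs → f a ≡ f b → a ≡ b
  unique-map⇒injective f {_ ∷ _} _             (here refl) (here refl) _ = refl
  unique-map⇒injective f {_ ∷ _} (fa∉ ∷ _)     (here refl) (there b∈) fa≡fb =
    ⊥-elim (All.lookup (All.map⁻ fa∉) b∈ fa≡fb)
  unique-map⇒injective f {_ ∷ _} (fb∉ ∷ _)     (there a∈) (here refl) fa≡fb =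
    ⊥-elim (All.lookup (All.map⁻ fb∉) a∈ (sym fa≡fb))
  unique-map⇒injective f {_ ∷ _} (_ ∷ fxs!)    (there a∈) (there b∈) fa≡fb =
    unique-map⇒injective f fxs! a∈ b∈ fa≡fb

  map-filter : ∀ (f : A → B) {P : B → Set} (P? : U.Decidable P) xs →
               map f (filter (P? ∘ f) xs) ≡ filter P? (map f xs)
  map-filter f P? [] = refl
  map-filter f P? (a ∷ xs) with does (P? (f a))
  ... | true  = cong (f a ∷_) (map-filter f P? xs)
  ... | false = map-filter f P? xs

  map-deduplicate : ∀ (_≟_ : DecidableEquality B) (f : A → B) xs →
                    map f (deduplicate (λ a a′ → f a ≟ f a′) xs) ≡ deduplicate _≟_ (map f xs)
  map-deduplicate _≟_ f [] = refl
  map-deduplicate _≟_ f (a ∷ xs) = cong (f a ∷_) (begin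
    map f (filter (¬? ∘ (f a ≟_) ∘ f) ys)          ≡⟨ map-filter f (¬? ∘ (f a ≟_)) ys ⟩
    filter (¬? ∘ (f a ≟_)) (map f ys)              ≡⟨ cong (filter _) (map-deduplicate _≟_ f xs) ⟩
    filter (¬? ∘ (f a ≟_)) (deduplicate _≟_ (map f xs)) ∎)
    where
      open ≡-Reasoning
      ys = deduplicate (λ a a′ → f a ≟ f a′) xs

  module _ (_≟_ : DecidableEquality A) where

    unique-⊆⇒length≤ : ∀ {xs ys : List A} → Unique xs → (∀ {a} → a ∈ xs → a ∈ ys) → length xs ≤ length ys
    unique-⊆⇒length≤ {[]}     _            _  = z≤n
    unique-⊆⇒length≤ {x ∷ xs} {ys} (x∉xs ∷ xs!) xs⊆ys = begin-strict
      length xs                         ≤⟨ unique-⊆⇒length≤ xs! xs⊆ys-x ⟩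
      length (filter (¬? ∘ (x ≟_)) ys)  <⟨ filter-notAll (¬? ∘ (x ≟_)) ys x∈ys ⟩
      length ys                         ∎
      where
        open ≤-Reasoning
        x∈ys : Any.Any (λ y → ¬ ¬ x ≡ y) ys
        x∈ys = Any.map (λ x≡y x≢y → x≢y x≡y) (xs⊆ys (here refl))
        xs⊆ys-x : ∀ {a} → a ∈ xs → a ∈ filter (¬? ∘ (x ≟_)) ys
        xs⊆ys-x a∈xs = ∈-filter⁺ (¬? ∘ (x ≟_)) (xs⊆ys (there a∈xs)) (All.lookup x∉xs a∈xs)

  module _ (_≟_ : DecidableEquality B) (f : A → B) (M : ℕ) where

    length≤fibre*image : ∀ xs ys → (∀ {a} → a ∈ xs → f a ∈ ys) →
                         (∀ b → countᵇ (λ a → isYes (f a ≟ b)) xs ≤ M) → length xs ≤ M * length ys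
    length≤fibre*image []       ys       _     _     = z≤n
    length≤fibre*image (a ∷ xs) []       xs↦ys _     with () ← xs↦ys (here refl)
    length≤fibre*image xs       (b ∷ ys) xs↦ys fibre = begin
      length xs
        ≡⟨ countᵇ+countᵇ-not (λ a → isYes (f a ≟ b)) xs ⟨
      countᵇ (λ a → isYes (f a ≟ b)) xs + length xs′
        ≤⟨ +-mono-≤ (fibre b) (length≤fibre*image xs′ ys xs′↦ys fibre′) ⟩
      M + M * length ys
        ≡⟨ *-suc M (length ys) ⟨
      M * length (b ∷ ys)
        ∎
      where
        open ≤-Reasoning
        xs′ = filterᵇ (λ a → isNo (f a ≟ b)) xs
        xs′↦ys : ∀ {a} → a ∈ xs′ → f a ∈ ys
        xs′↦ys a∈xs′ with ∈-filter⁻ (T? ∘ λ a → isNo (f a ≟ b)) {xs = xs} a∈xs′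
        ... | a∈xs , fa≢b with xs↦ys a∈xs
        ...   | here fa≡b   = ⊥-elim (toWitnessFalse fa≢b fa≡b)
        ...   | there fa∈ys = fa∈ys
        fibre′ : ∀ b′ → countᵇ (λ a → isYes (f a ≟ b′)) xs′ ≤ M
        fibre′ b′ = ≤-trans (≤-reflexive (countᵇ-filterᵇ _ _ xs))
                            (≤-trans (countᵇ-mono _ _ xs (λ _ → proj₂ ∘ T-∧⁻)) (fibre b′))

  words : ℕ → List A → List (List A)
  words zero    l = [] ∷ []
  words (suc k) l = concatMap (λ w → map (_∷ w) l) (words k l)

  length-words : ∀ k (l : List A) → length (words k l) ≡ length l ^ k
  length-words zero    l = refl
  length-words (suc k) l = begin
    length (concatMap (λ w → map (_∷ w) l) (words k l)) ≡⟨ length-concatMap _ (words k l) ⟩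
    ∑[ w ← words k l ] length (map (_∷ w) l)            ≡⟨ ∑-cong _ _ (words k l) (λ w → length-map (_∷ w) l) ⟩
    ∑[ _ ← words k l ] length l                         ≡⟨ ∑-const (length l) (words k l) ⟩
    length (words k l) * length l                       ≡⟨ cong (_* length l) (length-words k l) ⟩
    length l ^ k * length l                             ≡⟨ *-comm (length l ^ k) (length l) ⟩
    length l ^ suc k                                    ∎
    where open ≡-Reasoning

  ∈-words : ∀ {l : List A} {w} → All (_∈ l) w → w ∈ words (length w) l
  ∈-words []           = here refl
  ∈-words {l = l} (a∈l ∷ w⊆l) =
    ∈-concatMap⁺ (λ w → map (_∷ w) l) (Any.map (λ { refl → ∈-map⁺ (_∷ _) a∈l }) (∈-words w⊆l))

module Rationals where

  open import Data.Integer as ℤ using (+_; +[1+_]; -[1+_])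
  import Data.Integer.Properties as ℤ
  open import Data.Nat as ℕ using (ℕ; suc)
  import Data.Nat.Properties as ℕ
  open import Data.Nat.Coprimality using (1-coprimeTo)
  import Data.Nat.Coprimality as Coprime
  open import Data.Rational
  open import Data.Rational.Properties
  open import Data.Rational.Solver using (module +-*-Solver)

  toℚ : ℕ → ℚ
  toℚ m = mkℚ (+ m) 0 (Coprime.sym (1-coprimeTo m))

  /1≡toℚ : ∀ m → + m / 1 ≡ toℚ m
  /1≡toℚ m = normalize-coprime (Coprime.sym (1-coprimeTo m))

  toℚ-mono-≤ : ∀ {a b} → a ℕ.≤ b → toℚ a ≤ toℚ b
  toℚ-mono-≤ {a} {b} a≤b = *≤* (subst₂ ℤ._≤_ (sym (ℤ.*-identityʳ (+ a))) (sym (ℤ.*-identityʳ (+ b))) (ℤ.+≤+ a≤b))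

  toℚ-cancel-≤ : ∀ {a b} → toℚ a ≤ toℚ b → a ℕ.≤ b
  toℚ-cancel-≤ {a} {b} (*≤* a≤b) = ℤ.drop‿+≤+ (subst₂ ℤ._≤_ (ℤ.*-identityʳ (+ a)) (ℤ.*-identityʳ (+ b)) a≤b)

  toℚ-+ : ∀ a b → toℚ (a ℕ.+ b) ≡ toℚ a + toℚ b
  toℚ-+ a b = sym (trans (cong (_/ 1) (cong₂ ℤ._+_ (ℤ.*-identityʳ (+ a)) (ℤ.*-identityʳ (+ b)))) (/1≡toℚ (a ℕ.+ b)))

  toℚ-* : ∀ a b → toℚ (a ℕ.* b) ≡ toℚ a * toℚ b
  toℚ-* a b = sym (trans (cong (_/ 1) (sym (ℤ.pos-* a b))) (/1≡toℚ (a ℕ.* b)))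

  1/suc≡1/toℚ : ∀ m → + 1 / suc m ≡ 1/ toℚ (suc m)
  1/suc≡1/toℚ m = normalize-coprime (1-coprimeTo (suc m))

  toℚ*1/suc≡1 : ∀ m → toℚ (suc m) * (+ 1 / suc m) ≡ 1ℚ
  toℚ*1/suc≡1 m = trans (cong (toℚ (suc m) *_) (1/suc≡1/toℚ m)) (*-inverseʳ (toℚ (suc m)))

  1/suc-pos : ∀ m → 0ℚ < + 1 / suc m
  1/suc-pos m rewrite 1/suc≡1/toℚ m = *<* (ℤ.+<+ (ℕ.s≤s ℕ.z≤n))

  1/suc-antimono : ∀ {a b} → a ℕ.≤ b → + 1 / suc b ≤ + 1 / suc a
  1/suc-antimono {a} {b} a≤b rewrite 1/suc≡1/toℚ a | 1/suc≡1/toℚ b =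
    *≤* (subst₂ ℤ._≤_ (sym (ℤ.*-identityˡ (+ suc a))) (sym (ℤ.*-identityˡ (+ suc b))) (ℤ.+≤+ (ℕ.s≤s a≤b)))

  archimedean : ∀ ε → 0ℚ < ε → ∃ λ d → + 1 / suc d ≤ ε
  archimedean ε@(mkℚ +[1+ p ] d _) _ = d , subst (_≤ ε) (sym (1/suc≡1/toℚ d))
    (*≤* (subst₂ ℤ._≤_ (sym (ℤ.*-identityˡ (+ suc d))) refl (ℤ.+≤+ (ℕ.m≤m+n (suc d) (p ℕ.* suc d)))))
  archimedean (mkℚ (+ 0) d _) (*<* 0<0) =
    ⊥-elim (ℤ.<-irrefl refl (subst₂ ℤ._<_ (ℤ.*-zeroˡ (+ suc d)) (ℤ.*-zeroˡ (+ 1)) 0<0))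
  archimedean (mkℚ -[1+ p ] d _) (*<* 0<ε) with () ← subst₂ ℤ._<_ (ℤ.*-zeroˡ (+ suc d)) (ℤ.*-identityʳ -[1+ p ]) 0<ε

  toℚ-nonNeg : ∀ m → NonNegative (toℚ m)
  toℚ-nonNeg m = _

  clear-denominators : ∀ a d ε → + 1 / suc d ≤ ε → ∀ n c →
    (1ℚ - + 1 / suc a + ε) * (+ n / 1) ≤ + c / 1 →
    suc a ℕ.* suc d ℕ.* n ℕ.+ suc a ℕ.* n ℕ.≤ suc a ℕ.* suc d ℕ.* c ℕ.+ suc d ℕ.* n
  clear-denominators a d ε 1/D≤ε n c h = toℚ-cancel-≤ (subst₂ _≤_ (sym lhs) (sym rhs) scaled)
    where
      X = toℚ (suc a)
      Y = toℚ (suc d)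
      N = toℚ n
      C = toℚ c
      1/X = + 1 / suc a
      1/Y = + 1 / suc d
      open +-*-Solver
      identity : (X * Y) * ((1ℚ - 1/X + 1/Y) * N) + Y * N ≡ (X * Y) * N + X * N
      identity = begin
        (X * Y) * ((1ℚ - 1/X + 1/Y) * N) + Y * N
          ≡⟨ solve 5 (λ X Y a e N → (X :* Y) :* ((con 1ℚ :- a :+ e) :* N) :+ Y :* N
                       := X :* Y :* N :- (X :* a) :* Y :* N :+ X :* (Y :* e) :* N :+ Y :* N) refl X Y 1/X 1/Y N ⟩
        X * Y * N - (X * 1/X) * Y * N + X * (Y * 1/Y) * N + Y * N
          ≡⟨ cong₂ (λ u v → X * Y * N - u * Y * N + X * v * N + Y * N) (toℚ*1/suc≡1 a) (toℚ*1/suc≡1 d) ⟩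
        X * Y * N - 1ℚ * Y * N + X * 1ℚ * N + Y * N
          ≡⟨ solve 3 (λ X Y N → X :* Y :* N :- con 1ℚ :* Y :* N :+ X :* con 1ℚ :* N :+ Y :* N
                       := X :* Y :* N :+ X :* N) refl X Y N ⟩
        (X * Y) * N + X * N ∎
        where open ≡-Reasoning
      with-1/Y : (1ℚ - 1/X + 1/Y) * N ≤ C
      with-1/Y = ≤-trans (*-monoʳ-≤-nonNeg N {{toℚ-nonNeg n}} (+-monoʳ-≤ (1ℚ - 1/X) 1/D≤ε))
                         (subst₂ (λ u v → (1ℚ - 1/X + ε) * u ≤ v) (/1≡toℚ n) (/1≡toℚ c) h)
      scaled : (X * Y) * N + X * N ≤ (X * Y) * C + Y * N
      scaled = subst (_≤ (X * Y) * C + Y * N) identity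
        (+-monoˡ-≤ (Y * N) (*-monoˡ-≤-nonNeg (X * Y) {{subst NonNegative (toℚ-* (suc a) (suc d)) (toℚ-nonNeg _)}} with-1/Y))
      lhs : toℚ (suc a ℕ.* suc d ℕ.* n ℕ.+ suc a ℕ.* n) ≡ (X * Y) * N + X * N
      lhs = trans (toℚ-+ (suc a ℕ.* suc d ℕ.* n) (suc a ℕ.* n))
                  (cong₂ _+_ (trans (toℚ-* (suc a ℕ.* suc d) n) (cong (_* N) (toℚ-* (suc a) (suc d)))) (toℚ-* (suc a) n))
      rhs : toℚ (suc a ℕ.* suc d ℕ.* c ℕ.+ suc d ℕ.* n) ≡ (X * Y) * C + Y * N
      rhs = trans (toℚ-+ (suc a ℕ.* suc d ℕ.* c) (suc d ℕ.* n))
                  (cong₂ _+_ (trans (toℚ-* (suc a ℕ.* suc d) c) (cong (_* C) (toℚ-* (suc a) (suc d)))) (toℚ-* (suc d) n))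

  ≤-1/suc-scale : ∀ η d → η ≤ + 1 / suc d → ∀ N L → N ℕ.≤ L ℕ.* suc d → η * (+ N / 1) ≤ + L / 1
  ≤-1/suc-scale η d η≤1/D N L N≤LD = subst₂ (λ u v → η * u ≤ v) (sym (/1≡toℚ N)) (sym (/1≡toℚ L)) (begin
    η * toℚ N                 ≤⟨ *-monoʳ-≤-nonNeg (toℚ N) {{toℚ-nonNeg N}} η≤1/D ⟩
    1/D * toℚ N               ≤⟨ *-monoˡ-≤-nonNeg 1/D {{1/D-nonNeg}} (toℚ-mono-≤ N≤LD) ⟩
    1/D * toℚ (L ℕ.* suc d)   ≡⟨ cong (1/D *_) (toℚ-* L (suc d)) ⟩
    1/D * (toℚ L * D)         ≡⟨ solve 3 (λ r l d → r :* (l :* d) := l :* (d :* r)) refl 1/D (toℚ L) D ⟩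
    toℚ L * (D * 1/D)         ≡⟨ cong (toℚ L *_) (toℚ*1/suc≡1 d) ⟩
    toℚ L * 1ℚ                ≡⟨ *-identityʳ (toℚ L) ⟩
    toℚ L                     ∎)
    where
      open ≤-Reasoning
      open +-*-Solver
      D = toℚ (suc d)
      1/D = + 1 / suc d
      1/D-nonNeg : NonNegative 1/D
      1/D-nonNeg = pos⇒nonNeg 1/D {{positive (1/suc-pos d)}}

record RainbowChoice {n : ℕ} (G : ECGraph n) (x y : Fin n) : Set where
  field
    chosen                  : Fin n → Fin n → Bool
    chosen⇒adj              : ∀ {v u} → T (chosen v u) → adj G v u ≡ true
    chosen-colour-injective : ∀ {v u w} → T (chosen v u) → T (chosen v w) → col G v u ≡ col G v w → u ≡ w
    chosen-avoids-x         : ∀ {v u} → T (chosen v u) → col G v u ≢ col G v x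
    chosen-avoids-y         : ∀ {v u} → T (chosen v u) → col G v u ≢ col G v y

module RainbowNeighbourhoods {n : ℕ} (G : ECGraph n) where

  open import Data.Nat using (ℕ; _+_; _≤_)
  open import Data.Nat.Properties using (_≟_; +-mono-≤; module ≤-Reasoning)
  import Data.Bool as Bool
  import Data.Fin.Properties as Fin
  open import Data.List.Membership.DecPropositional (Fin._≟_ {n}) using (_∈?_)
  open import Data.List.Membership.Propositional.Properties using (∈-allFin; ∈-deduplicate⁻)
  open import Data.List.Relation.Unary.Unique.Propositional.Properties using (map⁻)
  open import Data.List.Relation.Unary.Unique.DecPropositional.Properties using (deduplicate-!)
  open Counting

  rainbowNbrs : Fin n → List (Fin n)
  rainbowNbrs v = deduplicate (λ u w → col G v u ≟ col G v w) (nbrs G v)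

  length-rainbowNbrs : ∀ v → length (rainbowNbrs v) ≡ colourDeg G v
  length-rainbowNbrs v = trans (sym (length-map (col G v) (rainbowNbrs v)))
                               (cong length (map-deduplicate _≟_ (col G v) (nbrs G v)))

  rainbowNbrs-colours-unique : ∀ v → Unique (map (col G v) (rainbowNbrs v))
  rainbowNbrs-colours-unique v = subst Unique (sym (map-deduplicate _≟_ (col G v) (nbrs G v))) (deduplicate-! _≟_ _)

  rainbowNbrs-colour-injective : ∀ v {u w} → u ∈ rainbowNbrs v → w ∈ rainbowNbrs v →
                                 col G v u ≡ col G v w → u ≡ w
  rainbowNbrs-colour-injective v = unique-map⇒injective (col G v) (rainbowNbrs-colours-unique v)

  rainbowNbrs⇒adj : ∀ v {u} → u ∈ rainbowNbrs v → adj G v u ≡ true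
  rainbowNbrs⇒adj v u∈ = proj₂ (∈-filter⁻ (λ u → adj G v u Bool.≟ true) {xs = allFin n}
                                  (∈-deduplicate⁻ (λ u w → col G v u ≟ col G v w) (nbrs G v) u∈))

  module _ (x y : Fin n) where

    avoidsColours : Fin n → Fin n → Bool
    avoidsColours v u = isNo (col G v u ≟ col G v x) ∧ isNo (col G v u ≟ col G v y)

    chosen : Fin n → Fin n → Bool
    chosen v u = isYes (u ∈? rainbowNbrs v) ∧ avoidsColours v u

    chosen⁻ : ∀ {v u} → T (chosen v u) → u ∈ rainbowNbrs v × col G v u ≢ col G v x × col G v u ≢ col G v y
    chosen⁻ {v} {u} c =
      let u∈ , avoids = T-∧⁻ {isYes (u ∈? rainbowNbrs v)} {avoidsColours v u} c
          ≢x , ≢y = T-∧⁻ {isNo (col G v u ≟ col G v x)} {isNo (col G v u ≟ col G v y)} avoids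
      in toWitness u∈ , toWitnessFalse ≢x , toWitnessFalse ≢y

    rainbowChoice : RainbowChoice G x y
    rainbowChoice = record
      { chosen                  = chosen
      ; chosen⇒adj              = λ {v} c → rainbowNbrs⇒adj v (proj₁ (chosen⁻ c))
      ; chosen-colour-injective = λ {v} cu cw → rainbowNbrs-colour-injective v (proj₁ (chosen⁻ cu)) (proj₁ (chosen⁻ cw))
      ; chosen-avoids-x         = proj₁ ∘ proj₂ ∘ chosen⁻
      ; chosen-avoids-y         = proj₂ ∘ proj₂ ∘ chosen⁻
      }

    colourDeg≤chosen+2 : ∀ v → colourDeg G v ≤ countᵇ (chosen v) (allFin n) + 2
    colourDeg≤chosen+2 v = begin
      colourDeg G v                                                      ≡⟨ length-rainbowNbrs v ⟨
      length rbl                                                         ≡⟨ countᵇ+countᵇ-not (avoidsColours v) rbl ⟨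
      countᵇ (avoidsColours v) rbl + countᵇ (not ∘ avoidsColours v) rbl  ≤⟨ +-mono-≤ kept dropped ⟩
      countᵇ (chosen v) (allFin n) + 2                                   ∎
      where
        open ≤-Reasoning
        rbl = rainbowNbrs v
        rbl! : Unique rbl
        rbl! = map⁻ (rainbowNbrs-colours-unique v)
        kept : countᵇ (avoidsColours v) rbl ≤ countᵇ (chosen v) (allFin n)
        kept = unique-⊆⇒length≤ Fin._≟_ (filter⁺ (T? ∘ avoidsColours v) rbl!) λ u∈ →
          let u∈rbl , avoids = ∈-filter⁻ (T? ∘ avoidsColours v) {xs = rbl} u∈
          in ∈-filter⁺ (T? ∘ chosen v) (∈-allFin _) (T-∧⁺ {isYes (_ ∈? rbl)} (fromWitness u∈rbl) avoids)
        sees : ℕ → Fin n → Bool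
        sees c u = isYes (col G v u ≟ c)
        at-most-one : ∀ c → countᵇ (sees c) rbl ≤ 1
        at-most-one c = countᵇ-≤1 (sees c) rbl! λ a∈ b∈ ac bc →
          rainbowNbrs-colour-injective v a∈ b∈ (trans (toWitness ac) (sym (toWitness bc)))
        dropped : countᵇ (not ∘ avoidsColours v) rbl ≤ 2
        dropped = begin
          countᵇ (not ∘ avoidsColours v) rbl
            ≤⟨ countᵇ-mono _ _ rbl (λ {u} _ → de-morgan {sees (col G v x) u}) ⟩
          countᵇ (λ u → sees (col G v x) u ∨ sees (col G v y) u) rbl
            ≤⟨ countᵇ-∨ _ _ rbl ⟩
          countᵇ (sees (col G v x)) rbl + countᵇ (sees (col G v y)) rbl
            ≤⟨ +-mono-≤ (at-most-one _) (at-most-one _) ⟩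
          2 ∎
          where
            de-morgan : ∀ {a b} → T (not (not a ∧ not b)) → T (a ∨ b)
            de-morgan {true}          _ = _
            de-morgan {false} {true}  _ = _

module Greedy {n : ℕ} {G : ECGraph n} {x y : Fin n} (ρ : RainbowChoice G x y) where

  open import Data.Nat using (ℕ; zero; suc; _+_; _*_; _∸_; _≤_; _<_; _<ᵇ_; _^_; z≤n; s≤s; NonZero; >-nonZero)
  open import Data.Nat.Properties
  open import Data.Nat.Tactic.RingSolver using (solve-∀)
  open import Data.List.Relation.Unary.Unique.Propositional.Properties using (allFin⁺; map⁺; concat⁺)
  import Data.List.Relation.Unary.AllPairs as AllPairs
  import Data.List.Relation.Unary.AllPairs.Properties as AllPairs
  open import Data.List.Relation.Binary.Disjoint.Propositional using () renaming (Disjoint to Disjointₗ)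
  open import Data.List.Properties using (∷-injectiveˡ; ∷-injectiveʳ; length-tabulate)
  open import Data.List.Relation.Unary.All.Properties using (all⁺)
  open import Data.List.Relation.Unary.Any.Properties using (any⁺)
  open Counting
  open RainbowChoice ρ

  missing : Fin n → ℕ
  missing v = countᵇ (not ∘ chosen v) (allFin n)

  mutuallyChosen : Fin n → Fin n → Bool
  mutuallyChosen v w = chosen v w ∧ chosen w v

  isCandidate : List (Fin n) → Fin n → Bool
  isCandidate S w = chosen x w ∧ chosen y w ∧ all (λ s → mutuallyChosen s w) S

  candidates : List (Fin n) → List (Fin n)
  candidates S = filterᵇ (isCandidate S) (allFin n)

  lost : List (Fin n) → Fin n → ℕ
  lost S v = countᵇ (not ∘ mutuallyChosen v) (candidates S)

  -- Pairs a = b, whose colour is junk, are included too: harmless, as clashes-count bounds all clashes.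
  clashes : List (Fin n) → Fin n → Bool
  clashes S v = any (λ u → any (λ a → any (λ b → isYes (col G u v ≟ col G a b)) K) K) K
    where K = x ∷ y ∷ S

  clashes⁺ : ∀ {S v u a b} → u ∈ x ∷ y ∷ S → a ∈ x ∷ y ∷ S → b ∈ x ∷ y ∷ S → col G u v ≡ col G a b →
             T (clashes S v)
  clashes⁺ {S} {v} u∈ a∈ b∈ uv≡ab =
    any⁺ (λ u → any (λ a → any (λ b → isYes (col G u v ≟ col G a b)) K) K) (Any.map (λ { refl →
    any⁺ (λ a → any (λ b → isYes (col G _ v ≟ col G a b)) K) (Any.map (λ { refl →
    any⁺ (λ b → isYes (col G _ v ≟ col G _ b)) (Any.map (λ { refl → fromWitness uv≡ab }) b∈) }) a∈) }) u∈)
    where K = x ∷ y ∷ S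

  candidates-unique : ∀ S → Unique (candidates S)
  candidates-unique S = filter⁺ (T? ∘ isCandidate S) (allFin⁺ n)

  mutuallyChosen⁻ : ∀ {v w} → T (mutuallyChosen v w) → T (chosen v w) × T (chosen w v)
  mutuallyChosen⁻ {v} {w} = T-∧⁻ {chosen v w}

  isCandidate⁻ : ∀ {S w} → T (isCandidate S w) →
                 T (chosen x w) × T (chosen y w) × All (λ s → T (mutuallyChosen s w)) S
  isCandidate⁻ {S} {w} c =
    let cx , rest = T-∧⁻ {chosen x w} c
        cy , all-S = T-∧⁻ {chosen y w} rest
    in cx , cy , all⁺ (λ s → mutuallyChosen s w) S all-S

  candidate⇒chosen : ∀ {S u w} → u ∈ x ∷ y ∷ S → T (isCandidate S w) → T (chosen u w)
  candidate⇒chosen {S} (here refl)         c = proj₁ (isCandidate⁻ {S} c)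
  candidate⇒chosen {S} (there (here refl)) c = proj₁ (proj₂ (isCandidate⁻ {S} c))
  candidate⇒chosen {S} (there (there u∈S)) c = proj₁ (mutuallyChosen⁻ (All.lookup (proj₂ (proj₂ (isCandidate⁻ {S} c))) u∈S))

  n≤candidates[]+missing : n ≤ length (candidates []) + missing x + missing y
  n≤candidates[]+missing = begin
    n
      ≡⟨ trans (countᵇ+countᵇ-not (chosen x) (allFin n)) (length-tabulate id) ⟨
    countᵇ (chosen x) (allFin n) + missing x
      ≡⟨ cong (_+ missing x) (countᵇ-split (chosen x) (chosen y) (allFin n)) ⟩
    countᵇ (λ w → chosen x w ∧ chosen y w) (allFin n) + countᵇ (λ w → chosen x w ∧ not (chosen y w)) (allFin n) + missing x
      ≤⟨ +-monoˡ-≤ (missing x) (+-mono-≤ (countᵇ-mono _ _ (allFin n) (λ {w} _ → ∧-true {chosen x w}))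
                                          (countᵇ-mono _ _ (allFin n) (λ {w} _ → proj₂ ∘ T-∧⁻ {chosen x w}))) ⟩
    length (candidates []) + missing y + missing x
      ≡⟨ swap (length (candidates [])) (missing y) (missing x) ⟩
    length (candidates []) + missing x + missing y
      ∎
    where
      open ≤-Reasoning
      ∧-true : ∀ {a b} → T (a ∧ b) → T (a ∧ (b ∧ true))
      ∧-true {true} {true} _ = _
      swap : ∀ a b c → a + b + c ≡ a + c + b
      swap = solve-∀

  candidates-∷ : ∀ S v → length (candidates S) ≡ length (candidates (v ∷ S)) + lost S v
  candidates-∷ S v = begin
    length (candidates S)
      ≡⟨ countᵇ+countᵇ-not (mutuallyChosen v) (candidates S) ⟨
    countᵇ (mutuallyChosen v) (candidates S) + lost S v
      ≡⟨ cong (_+ lost S v) (countᵇ-filterᵇ (isCandidate S) (mutuallyChosen v) (allFin n)) ⟩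
    countᵇ (λ w → isCandidate S w ∧ mutuallyChosen v w) (allFin n) + lost S v
      ≡⟨ cong (_+ lost S v) (countᵇ-cong _ _ (allFin n) (λ w → reassoc (chosen x w) (chosen y w) _ _)) ⟩
    length (candidates (v ∷ S)) + lost S v
      ∎
    where
      open ≡-Reasoning
      reassoc : ∀ a b c d → (a ∧ b ∧ c) ∧ d ≡ a ∧ b ∧ d ∧ c
      reassoc false _     _ _ = refl
      reassoc true  false _ _ = refl
      reassoc true  true  c d = ∧-comm c d

  lost≤missing+unchosen : ∀ S v → lost S v ≤ missing v + countᵇ (λ w → not (chosen w v)) (candidates S)
  lost≤missing+unchosen S v = begin
    lost S v                                               ≤⟨ countᵇ-mono _ _ C (λ {w} _ → de-morgan {chosen v w}) ⟩
    countᵇ (λ w → not (chosen v w) ∨ not (chosen w v)) C   ≤⟨ countᵇ-∨ _ _ C ⟩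
    countᵇ (not ∘ chosen v) C + countᵇ (λ w → not (chosen w v)) C
                                                           ≤⟨ +-monoˡ-≤ _ (countᵇ-filterᵇ-≤ (isCandidate S) _ (allFin n)) ⟩
    missing v + countᵇ (λ w → not (chosen w v)) C          ∎
    where
      open ≤-Reasoning
      C = candidates S
      de-morgan : ∀ {a b} → T (not (a ∧ b)) → T (not a ∨ not b)
      de-morgan {false}        _ = _
      de-morgan {true} {false} _ = _

  -- Double counting: the candidates v not chosen by a candidate w number at most missing w.
  ∑-lost : ∀ S → ∑[ v ← candidates S ] lost S v ≤ ∑[ v ← candidates S ] missing v + ∑[ v ← candidates S ] missing v
  ∑-lost S = begin
    ∑[ v ← C ] lost S v
      ≤⟨ ∑-mono _ _ C (λ _ → lost≤missing+unchosen S _) ⟩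
    ∑[ v ← C ] (missing v + countᵇ (λ w → not (chosen w v)) C)
      ≡⟨ ∑-+ missing _ C ⟩
    ∑[ v ← C ] missing v + ∑[ v ← C ] countᵇ (λ w → not (chosen w v)) C
      ≡⟨ cong (∑[ v ← C ] missing v +_) (∑-countᵇ-comm (λ v w → not (chosen w v)) C C) ⟩
    ∑[ v ← C ] missing v + ∑[ w ← C ] countᵇ (λ v → not (chosen w v)) C
      ≤⟨ +-monoʳ-≤ _ (∑-mono _ _ C (λ {w} _ → countᵇ-filterᵇ-≤ (isCandidate S) (not ∘ chosen w) (allFin n))) ⟩
    ∑[ v ← C ] missing v + ∑[ w ← C ] missing w
      ∎
    where
      open ≤-Reasoning
      C = candidates S

  clashes-count : ∀ S → countᵇ (clashes S) (candidates S) ≤ length (x ∷ y ∷ S) ^ 3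
  clashes-count S = countᵇ-any³ sameColour (x ∷ y ∷ S) (candidates S) at-most-one
    where
      sameColour : Fin n → Fin n → Fin n → Fin n → Bool
      sameColour u a b v = isYes (col G u v ≟ col G a b)
      at-most-one : ∀ {u} → u ∈ x ∷ y ∷ S → ∀ a b → countᵇ (sameColour u a b) (candidates S) ≤ 1
      at-most-one u∈K a b = countᵇ-≤1 _ (candidates-unique S) λ v∈C w∈C uv uw →
        chosen-colour-injective (candidate⇒chosen u∈K (proj₂ (∈-filter⁻ (T? ∘ isCandidate S) {xs = allFin n} v∈C)))
                                (candidate⇒chosen u∈K (proj₂ (∈-filter⁻ (T? ∘ isCandidate S) {xs = allFin n} w∈C)))
                                (trans (toWitness uv) (sym (toWitness uw)))

  -- Sequences are stored newest vertex first.
  data Admissible : List (Fin n) → Set where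
    []  : Admissible []
    _∷_ : ∀ {v S} → T (isCandidate S v) × ¬ T (clashes S v) → Admissible S → Admissible (v ∷ S)

  module Sequences (Q τ : ℕ) where

    isCostly : List (Fin n) → Fin n → Bool
    isCostly S v = τ <ᵇ Q * lost S v

    opaque
      extensions : List (Fin n) → List (Fin n)
      extensions S = filterᵇ (λ v → not (isCostly S v ∨ clashes S v)) (candidates S)

    sequences : ℕ → List (List (Fin n))
    sequences zero    = [] ∷ []
    sequences (suc i) = concatMap (λ S → map (_∷ S) (extensions S)) (sequences i)

    opaque
      unfolding extensions

      extensions-unique : ∀ S → Unique (extensions S)
      extensions-unique S = filter⁺ _ (candidates-unique S)

      ∈-extensions⁻ : ∀ {S v} → v ∈ extensions S → T (isCandidate S v) × Q * lost S v ≤ τ × ¬ T (clashes S v)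
      ∈-extensions⁻ {S} {v} v∈ =
        let v∈C , fine = ∈-filter⁻ (T? ∘ λ v → not (isCostly S v ∨ clashes S v)) {xs = candidates S} v∈
            candidate  = proj₂ (∈-filter⁻ (T? ∘ isCandidate S) {xs = allFin n} v∈C)
        in candidate , ≮⇒≥ (T-not⇒¬T fine ∘ cheap) , T-not⇒¬T fine ∘ clash
        where
          cheap : τ < Q * lost S v → T (isCostly S v ∨ clashes S v)
          cheap τ<Ql = Equivalence.from (T-∨ {isCostly S v}) (inj₁ (<⇒<ᵇ τ<Ql))
          clash : T (clashes S v) → T (isCostly S v ∨ clashes S v)
          clash c = Equivalence.from (T-∨ {isCostly S v}) (inj₂ c)

      cheap≤extensions+clashes : ∀ S → countᵇ (not ∘ isCostly S) (candidates S) ≤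
                                     length (extensions S) + countᵇ (clashes S) (candidates S)
      cheap≤extensions+clashes S = begin
        countᵇ (not ∘ isCostly S) C
          ≡⟨ countᵇ-split (not ∘ isCostly S) (not ∘ clashes S) C ⟩
        countᵇ (λ v → not (isCostly S v) ∧ not (clashes S v)) C + countᵇ (λ v → not (isCostly S v) ∧ not (not (clashes S v))) C
          ≤⟨ +-mono-≤ (≤-reflexive (countᵇ-cong _ _ C (λ v → sym (not-∨ (isCostly S v) (clashes S v)))))
                      (countᵇ-mono _ _ C (λ {v} _ → clashing {isCostly S v})) ⟩
        length (extensions S) + countᵇ (clashes S) C
          ∎
        where
          open ≤-Reasoning
          C : List (Fin n)
          C = candidates S
          not-∨ : ∀ a b → not (a ∨ b) ≡ not a ∧ not b
          not-∨ true  _ = refl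
          not-∨ false _ = refl
          clashing : ∀ {a b} → T (not a ∧ not (not b)) → T b
          clashing {false} {true} _ = _

    costly-count : ∀ S → let C = candidates S in
                   countᵇ (isCostly S) C * suc τ ≤ ∑[ v ← C ] (Q * missing v) + ∑[ v ← C ] (Q * missing v)
    costly-count S = begin
      countᵇ (isCostly S) C * suc τ                         ≤⟨ markov (λ v → Q * lost S v) τ C ⟩
      ∑[ v ← C ] (Q * lost S v)                             ≡⟨ ∑-*ˡ Q (lost S) C ⟩
      Q * ∑[ v ← C ] lost S v                               ≤⟨ *-monoʳ-≤ Q (∑-lost S) ⟩
      Q * (∑[ v ← C ] missing v + ∑[ v ← C ] missing v)     ≡⟨ *-distribˡ-+ Q _ _ ⟩
      Q * ∑[ v ← C ] missing v + Q * ∑[ v ← C ] missing v   ≡⟨ cong₂ _+_ (∑-*ˡ Q missing C) (∑-*ˡ Q missing C) ⟨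
      ∑[ v ← C ] (Q * missing v) + ∑[ v ← C ] (Q * missing v) ∎
      where
        open ≤-Reasoning
        C = candidates S

    ∈-sequences⁻ : ∀ i {S′} → S′ ∈ sequences (suc i) →
                   ∃ λ v → ∃ λ S → S′ ≡ v ∷ S × S ∈ sequences i × v ∈ extensions S
    ∈-sequences⁻ i S′∈ with find (∈-concatMap⁻ (λ S → map (_∷ S) (extensions S)) {xs = sequences i} S′∈)
    ... | S , S∈ , S′∈ext with ∈-map⁻ (_∷ S) S′∈ext
    ...   | v , v∈ , refl = v , S , refl , S∈ , v∈

    length-sequences-suc : ∀ i → length (sequences (suc i)) ≡ ∑[ S ← sequences i ] length (extensions S)
    length-sequences-suc i = trans (length-concatMap _ (sequences i))
                                   (∑-cong _ _ (sequences i) (λ S → length-map (_∷ S) (extensions S)))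

    ∈-sequences⇒length : ∀ i {S} → S ∈ sequences i → length S ≡ i
    ∈-sequences⇒length zero    (here refl) = refl
    ∈-sequences⇒length (suc i) S′∈ with ∈-sequences⁻ i S′∈
    ... | _ , _ , refl , S∈ , _ = cong suc (∈-sequences⇒length i S∈)

    ∈-sequences⇒admissible : ∀ i {S} → S ∈ sequences i → Admissible S
    ∈-sequences⇒admissible zero    (here refl) = []
    ∈-sequences⇒admissible (suc i) S′∈ with ∈-sequences⁻ i S′∈
    ... | _ , S , refl , S∈ , v∈ =
      let candidate , _ , no-clash = ∈-extensions⁻ {S} v∈
      in (candidate , no-clash) ∷ ∈-sequences⇒admissible i S∈

    sequences-unique : ∀ i → Unique (sequences i)
    sequences-unique zero    = [] ∷ []
    sequences-unique (suc i) =
      concat⁺ (All.map⁺ (All.tabulate λ {S} _ → map⁺ ∷-injectiveˡ (extensions-unique S)))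
              (AllPairs.map⁺ (AllPairs.map disjoint (sequences-unique i)))
      where
        disjoint : ∀ {S S′} → S ≢ S′ → Disjointₗ (map (_∷ S) (extensions S)) (map (_∷ S′) (extensions S′))
        disjoint S≢S′ (vS∈ , wS′∈) with ∈-map⁻ (_∷ _) vS∈ | ∈-map⁻ (_∷ _) wS′∈
        ... | _ , _ , refl | _ , _ , vS≡wS′ = S≢S′ (∷-injectiveʳ vS≡wS′)

  module Analysis (k q : ℕ) (K≤q : suc k ≤ q) (n-large : 4 * q * q * suc (suc k) ^ 3 ≤ n)
                  (missing-bound : ∀ v → 2 * suc k * q * missing v + 2 * suc k * n ≤ q * n + 2 * (2 * suc k * q)) where

    -- Scaled by 1/Q, missing-bound reads missing v ≤ n/(2K) − n/q + 2, and a candidate is costly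
    -- when it destroys more than τ/Q = n/K − n/q + 4 other candidates.
    K Q c A τ P : ℕ
    K = suc k
    Q = 2 * K * q
    c = 2 * K * n
    A = q * n + 2 * Q
    τ = (A + A) ∸ c
    P = 4 * q * q

    open Sequences Q τ public

    c≤A+A : c ≤ A + A
    c≤A+A = begin
      2 * K * n          ≤⟨ *-monoˡ-≤ n (*-monoʳ-≤ 2 K≤q) ⟩
      2 * q * n          ≡⟨ double q n ⟩
      q * n + q * n      ≤⟨ +-mono-≤ (m≤m+n (q * n) _) (m≤m+n (q * n) _) ⟩
      A + A              ∎
      where
        open ≤-Reasoning
        double : ∀ q n → 2 * q * n ≡ q * n + q * n
        double = solve-∀

    τ+c≡A+A : τ + c ≡ A + A
    τ+c≡A+A = m∸n+n≡m c≤A+A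

    candidates-invariant : ∀ i {S} → S ∈ sequences i → Q * n + 2 * c ≤ Q * length (candidates S) + i * τ + (A + A)
    candidates-invariant zero (here refl) = begin
      Q * n + 2 * c                                   ≤⟨ +-monoˡ-≤ (2 * c) (*-monoʳ-≤ Q n≤candidates[]+missing) ⟩
      Q * (C + missing x + missing y) + 2 * c         ≡⟨ distrib Q C (missing x) (missing y) c ⟩
      Q * C + (Q * missing x + c) + (Q * missing y + c) ≤⟨ +-mono-≤ (+-monoʳ-≤ (Q * C) (missing-bound x)) (missing-bound y) ⟩
      Q * C + A + A                                   ≡⟨ +-assoc (Q * C) A A ⟩
      Q * C + (A + A)                                 ≡⟨ cong (_+ (A + A)) (+-identityʳ (Q * C)) ⟨
      Q * C + 0 * τ + (A + A)                         ∎
      where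
        open ≤-Reasoning
        C = length (candidates [])
        distrib : ∀ Q w a b c → Q * (w + a + b) + 2 * c ≡ Q * w + (Q * a + c) + (Q * b + c)
        distrib = solve-∀
    candidates-invariant (suc i) S′∈ with ∈-sequences⁻ i S′∈
    ... | v , S , refl , S∈ , v∈ = begin
      Q * n + 2 * c                               ≤⟨ candidates-invariant i S∈ ⟩
      Q * length (candidates S) + i * τ + (A + A) ≡⟨ cong (λ z → Q * z + i * τ + (A + A)) (candidates-∷ S v) ⟩
      Q * (w + lost S v) + i * τ + (A + A)        ≡⟨ distrib Q w (lost S v) (i * τ) (A + A) ⟩
      Q * w + Q * lost S v + i * τ + (A + A)      ≤⟨ +-monoˡ-≤ (A + A) (+-monoˡ-≤ (i * τ) (+-monoʳ-≤ (Q * w) cheap)) ⟩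
      Q * w + τ + i * τ + (A + A)                 ≡⟨ cong (_+ (A + A)) (+-assoc (Q * w) τ (i * τ)) ⟩
      Q * w + suc i * τ + (A + A)                 ∎
      where
        open ≤-Reasoning
        w = length (candidates (v ∷ S))
        cheap : Q * lost S v ≤ τ
        cheap = proj₁ (proj₂ (∈-extensions⁻ {S} v∈))
        distrib : ∀ Q w l t a → Q * (w + l) + t + a ≡ Q * w + Q * l + t + a
        distrib = solve-∀

    many-candidates : ∀ {i S} → i ≤ k → S ∈ sequences i → 2 * n ≤ q * length (candidates S) + 4 * K * q
    many-candidates {i} {S} i≤k S∈ = *-cancelˡ-≤ (2 * K) (begin
      2 * K * (2 * n)              ≡⟨ swap k n ⟩
      2 * c                        ≤⟨ +-cancelˡ-≤ (Q * n) _ _ (≤-trans (m≤m+n (Q * n + 2 * c) (k * c)) invariant) ⟩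
      Q * w + 4 * K * Q            ≡⟨ factor k q w ⟩
      2 * K * (q * w + 4 * K * q)  ∎)
      where
        open ≤-Reasoning
        w = length (candidates S)
        invariant : Q * n + 2 * c + k * c ≤ Q * n + (Q * w + 4 * K * Q)
        invariant = begin
          Q * n + 2 * c + k * c                 ≤⟨ +-monoˡ-≤ (k * c) (candidates-invariant i S∈) ⟩
          Q * w + i * τ + (A + A) + k * c       ≤⟨ +-monoˡ-≤ (k * c) (+-monoˡ-≤ (A + A) (+-monoʳ-≤ (Q * w) (*-monoˡ-≤ τ i≤k))) ⟩
          Q * w + k * τ + (A + A) + k * c       ≡⟨ regroup (Q * w) k τ (A + A) c ⟩
          Q * w + k * (τ + c) + (A + A)         ≡⟨ cong (λ z → Q * w + k * z + (A + A)) τ+c≡A+A ⟩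
          Q * w + k * (A + A) + (A + A)         ≡⟨ expand k q n w ⟩
          Q * n + (Q * w + 4 * K * Q)           ∎
          where
            regroup : ∀ a k t b c → a + k * t + b + k * c ≡ a + k * (t + c) + b
            regroup = solve-∀
            expand : ∀ k q n w → let Q = 2 * suc k * q; A = q * n + 2 * Q in
                     Q * w + k * (A + A) + (A + A) ≡ Q * n + (Q * w + 4 * suc k * Q)
            expand = solve-∀
        swap : ∀ k n → 2 * suc k * (2 * n) ≡ 2 * (2 * suc k * n)
        swap = solve-∀
        factor : ∀ k q w → 2 * suc k * q * w + 4 * suc k * (2 * suc k * q) ≡ 2 * suc k * (q * w + 4 * suc k * q)
        factor = solve-∀

    candidates-missing : ∀ S → ∑[ v ← candidates S ] (Q * missing v) + length (candidates S) * c ≤ length (candidates S) * A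
    candidates-missing S = begin
      ∑[ v ← C ] (Q * missing v) + length C * c  ≡⟨ cong (∑[ v ← C ] (Q * missing v) +_) (∑-const c C) ⟨
      ∑[ v ← C ] (Q * missing v) + ∑[ _ ← C ] c  ≡⟨ ∑-+ (λ v → Q * missing v) (λ _ → c) C ⟨
      ∑[ v ← C ] (Q * missing v + c)             ≤⟨ ∑-mono _ _ C (λ {v} _ → missing-bound v) ⟩
      ∑[ _ ← C ] A                               ≡⟨ ∑-const A C ⟩
      length C * A                               ∎
      where
        open ≤-Reasoning
        C = candidates S

    cheap-candidates : ∀ S → length (candidates S) * c ≤ countᵇ (not ∘ isCostly S) (candidates S) * τ
    cheap-candidates S = averaging {countᵇ (isCostly S) C} {countᵇ (not ∘ isCostly S) C}
                                   (countᵇ+countᵇ-not (isCostly S) C) (costly-count S) (candidates-missing S)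
      where
        C = candidates S
        averaging : ∀ {h l w M} → h + l ≡ w → h * suc τ ≤ M + M → M + w * c ≤ w * A → w * c ≤ l * τ
        averaging {h} {l} {w} {M} h+l≡w h≤ M≤ = +-cancelˡ-≤ (h * τ) _ _ (+-cancelʳ-≤ (w * c) _ _ (begin
          h * τ + w * c + w * c       ≤⟨ +-monoˡ-≤ (w * c) (+-monoˡ-≤ (w * c) (*-monoʳ-≤ h (n≤1+n τ))) ⟩
          h * suc τ + w * c + w * c   ≤⟨ +-monoˡ-≤ (w * c) (+-monoˡ-≤ (w * c) h≤) ⟩
          M + M + w * c + w * c       ≡⟨ shuffle M (w * c) ⟩
          (M + w * c) + (M + w * c)   ≤⟨ +-mono-≤ M≤ M≤ ⟩
          w * A + w * A               ≡⟨ *-distribˡ-+ w A A ⟨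
          w * (A + A)                 ≡⟨ cong (w *_) τ+c≡A+A ⟨
          w * (τ + c)                 ≡⟨ *-distribˡ-+ w τ c ⟩
          w * τ + w * c               ≡⟨ cong (λ z → z * τ + w * c) h+l≡w ⟨
          (h + l) * τ + w * c         ≡⟨ cong (_+ w * c) (*-distribʳ-+ τ h l) ⟩
          h * τ + l * τ + w * c       ∎))
          where
            open ≤-Reasoning
            shuffle : ∀ a b → a + a + b + b ≡ (a + b) + (a + b)
            shuffle = solve-∀

    4Kq≤n : 4 * K * q ≤ n
    4Kq≤n = begin
      4 * K * q                       ≤⟨ *-monoˡ-≤ q (*-monoʳ-≤ 4 K≤q) ⟩
      4 * q * q                       ≤⟨ m≤m*n (4 * q * q) (suc (suc k) ^ 3) ⟩
      4 * q * q * suc (suc k) ^ 3     ≤⟨ n-large ⟩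
      n                               ∎
      where open ≤-Reasoning

    4K≤n : 4 * K ≤ n
    4K≤n = ≤-trans (m≤m*n (4 * K) q {{>-nonZero (≤-trans (s≤s z≤n) K≤q)}}) 4Kq≤n

    many-cheap : ∀ {i S} → i ≤ k → S ∈ sequences i → 2 * n ≤ countᵇ (not ∘ isCostly S) (candidates S) * P
    many-cheap {i} {S} i≤k S∈ = ≤-trans (*-monoˡ-≤ n (*-monoʳ-≤ 2 (s≤s (z≤n {k})))) (*-cancelˡ-≤ n {{n≢0}} (begin
      n * c                  ≤⟨ *-monoˡ-≤ c n≤qw ⟩
      q * w * c              ≡⟨ *-assoc q w c ⟩
      q * (w * c)            ≤⟨ *-monoʳ-≤ q (cheap-candidates S) ⟩
      q * (l * τ)            ≤⟨ *-monoʳ-≤ q (*-monoʳ-≤ l τ≤4qn) ⟩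
      q * (l * (4 * q * n))  ≡⟨ regroup q l n ⟩
      n * (l * P)            ∎))
      where
        open ≤-Reasoning
        w = length (candidates S)
        l = countᵇ (not ∘ isCostly S) (candidates S)
        n≢0 : NonZero n
        n≢0 = >-nonZero (≤-trans (s≤s z≤n) 4K≤n)
        n≤qw : n ≤ q * w
        n≤qw = +-cancelʳ-≤ n n (q * w) (begin
          n + n                ≡⟨ cong (n +_) (+-identityʳ n) ⟨
          2 * n                ≤⟨ many-candidates i≤k S∈ ⟩
          q * w + 4 * K * q    ≤⟨ +-monoʳ-≤ (q * w) 4Kq≤n ⟩
          q * w + n            ∎)
        τ≤4qn : τ ≤ 4 * q * n
        τ≤4qn = begin
          τ                          ≤⟨ m≤m+n τ c ⟩
          τ + c                      ≡⟨ τ+c≡A+A ⟩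
          A + A                      ≡⟨ expand k q n ⟩
          2 * q * n + 2 * q * (4 * K) ≤⟨ +-monoʳ-≤ (2 * q * n) (*-monoʳ-≤ (2 * q) 4K≤n) ⟩
          2 * q * n + 2 * q * n      ≡⟨ double q n ⟩
          4 * q * n                  ∎
          where
            expand : ∀ k q n → let A = q * n + 2 * (2 * suc k * q) in A + A ≡ 2 * q * n + 2 * q * (4 * suc k)
            expand = solve-∀
            double : ∀ q n → 2 * q * n + 2 * q * n ≡ 4 * q * n
            double = solve-∀
        regroup : ∀ q l n → q * (l * (4 * q * n)) ≡ n * (l * (4 * q * q))
        regroup = solve-∀

    many-extensions : ∀ {i S} → i ≤ k → S ∈ sequences i → n ≤ length (extensions S) * P
    many-extensions {i} {S} i≤k S∈ = +-cancelʳ-≤ n n (e * P) (begin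
      n + n                      ≡⟨ cong (n +_) (+-identityʳ n) ⟨
      2 * n                      ≤⟨ many-cheap i≤k S∈ ⟩
      l * P                      ≤⟨ *-monoˡ-≤ P (cheap≤extensions+clashes S) ⟩
      (e + b) * P                ≡⟨ *-distribʳ-+ P e b ⟩
      e * P + b * P              ≤⟨ +-monoʳ-≤ (e * P) (*-monoˡ-≤ P b≤B) ⟩
      e * P + suc K ^ 3 * P      ≡⟨ cong (e * P +_) (*-comm (suc K ^ 3) P) ⟩
      e * P + P * suc K ^ 3      ≤⟨ +-monoʳ-≤ (e * P) n-large ⟩
      e * P + n                  ∎)
      where
        open ≤-Reasoning
        e = length (extensions S)
        l = countᵇ (not ∘ isCostly S) (candidates S)
        b = countᵇ (clashes S) (candidates S)
        b≤B : b ≤ suc K ^ 3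
        b≤B = ≤-trans (clashes-count S) (^-monoˡ-≤ 3 (s≤s (s≤s (≤-trans (≤-reflexive (∈-sequences⇒length i S∈)) i≤k))))

    many-sequences : ∀ i → i ≤ K → n ^ i ≤ length (sequences i) * P ^ i
    many-sequences zero    _         = ≤-refl
    many-sequences (suc i) (s≤s i≤k) = begin
      n * n ^ i                               ≤⟨ *-monoʳ-≤ n (many-sequences i (m≤n⇒m≤1+n i≤k)) ⟩
      n * (length (sequences i) * P ^ i)      ≡⟨ *-assoc n _ _ ⟨
      n * length (sequences i) * P ^ i        ≤⟨ *-monoˡ-≤ (P ^ i) one-step ⟩
      length (sequences (suc i)) * P * P ^ i  ≡⟨ *-assoc (length (sequences (suc i))) P (P ^ i) ⟩
      length (sequences (suc i)) * P ^ suc i  ∎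
      where
        open ≤-Reasoning
        one-step : n * length (sequences i) ≤ length (sequences (suc i)) * P
        one-step = begin
          n * length (sequences i)                           ≡⟨ *-comm n _ ⟩
          length (sequences i) * n                           ≡⟨ ∑-const n (sequences i) ⟨
          ∑[ _ ← sequences i ] n                             ≤⟨ ∑-mono _ _ (sequences i) (many-extensions i≤k) ⟩
          ∑[ S ← sequences i ] (length (extensions S) * P)   ≡⟨ ∑-cong _ _ (sequences i) (λ S → *-comm _ P) ⟩
          ∑[ S ← sequences i ] (P * length (extensions S))   ≡⟨ ∑-*ˡ P _ (sequences i) ⟩
          P * ∑[ S ← sequences i ] length (extensions S)     ≡⟨ cong (P *_) (length-sequences-suc i) ⟨
          P * length (sequences (suc i))                     ≡⟨ *-comm P _ ⟩
          length (sequences (suc i)) * P                     ∎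

module Subsets where

  open import Data.Nat using (suc)
  open import Data.Vec using (_∷_)
  open import Data.Fin using (zero; suc)
  open import Data.Fin.Subset using (Subset; _∪_; ⁅_⁆; ∣_∣; ⊥) renaming (_∈_ to _∈ₛ_; _∉_ to _∉ₛ_)
  open import Data.Fin.Subset.Properties using (x∈p∪q⁻; x∈p∪q⁺; x∈⁅x⁆; x∈⁅y⁆⇒x≡y; ∉⊥; ∪-identityʳ; ∣⊥∣≡0)

  toSubset : ∀ {n} → List (Fin n) → Subset n
  toSubset []      = ⊥
  toSubset (v ∷ l) = toSubset l ∪ ⁅ v ⁆

  ∈-toSubset⁻ : ∀ {n} (l : List (Fin n)) {u} → u ∈ₛ toSubset l → u ∈ l
  ∈-toSubset⁻ []      u∈ = ⊥-elim (∉⊥ u∈)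
  ∈-toSubset⁻ (v ∷ l) u∈ with x∈p∪q⁻ (toSubset l) ⁅ v ⁆ u∈
  ... | inj₁ u∈l = there (∈-toSubset⁻ l u∈l)
  ... | inj₂ u∈v = here (x∈⁅y⁆⇒x≡y v u∈v)

  ∈-toSubset⁺ : ∀ {n} {l : List (Fin n)} {u} → u ∈ l → u ∈ₛ toSubset l
  ∈-toSubset⁺ {l = v ∷ _} (here refl) = x∈p∪q⁺ (inj₂ (x∈⁅x⁆ v))
  ∈-toSubset⁺             (there u∈)  = x∈p∪q⁺ (inj₁ (∈-toSubset⁺ u∈))

  ∣∪⁅⁆∣ : ∀ {n} (p : Subset n) {v} → v ∉ₛ p → ∣ p ∪ ⁅ v ⁆ ∣ ≡ suc ∣ p ∣
  ∣∪⁅⁆∣ (true  ∷ p) {zero}  v∉ = ⊥-elim (v∉ Data.Vec.here)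
  ∣∪⁅⁆∣ (false ∷ p) {zero}  v∉ = cong suc (cong ∣_∣ (∪-identityʳ p))
  ∣∪⁅⁆∣ (true  ∷ p) {suc v} v∉ = cong suc (∣∪⁅⁆∣ p (v∉ ∘ Data.Vec.there))
  ∣∪⁅⁆∣ (false ∷ p) {suc v} v∉ = ∣∪⁅⁆∣ p (v∉ ∘ Data.Vec.there)

  ∣toSubset∣ : ∀ {n} {l : List (Fin n)} → Unique l → ∣ toSubset l ∣ ≡ length l
  ∣toSubset∣ {n} {[]}    []         = ∣⊥∣≡0 n
  ∣toSubset∣ {l = v ∷ l} (v∉ ∷ l!) =
    trans (∣∪⁅⁆∣ (toSubset l) (λ v∈ → All.lookup v∉ (∈-toSubset⁻ l v∈) refl)) (cong suc (∣toSubset∣ l!))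

module Connectors {n : ℕ} {G : ECGraph n} {x y : Fin n} (ρ : RainbowChoice G x y) where

  open import Data.Nat using (suc)
  open import Data.Nat.Properties using (*-identityʳ)
  open import Function.Bundles using (mk⇔)
  open RainbowChoice ρ
  open Greedy ρ using (Admissible; []; _∷_; isCandidate; isCandidate⁻; mutuallyChosen⁻; candidate⇒chosen; clashes⁺)
  open Subsets

  adj⇒≢ : ∀ {a b} → adj G a b ≡ true → a ≢ b
  adj⇒≢ {a} a~b refl with () ← trans (sym a~b) (adj-irr G a)

  candidate⇒chosen-by : ∀ {S w} → T (isCandidate S w) → All (λ s → T (chosen w s)) S
  candidate⇒chosen-by {S} c = All.map (proj₂ ∘ mutuallyChosen⁻) (proj₂ (proj₂ (isCandidate⁻ {S} c)))

  IsRainbow : List (Fin n) → Set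
  IsRainbow K = ∀ {u v u′ v′} → u ∈ K → v ∈ K → u′ ∈ K → v′ ∈ K → u ≢ v → u′ ≢ v′ →
                col G u v ≡ col G u′ v′ → (u ≡ u′ × v ≡ v′) ⊎ (u ≡ v′ × v ≡ u′)

  endpoint-∈ : ∀ {z S u} → z ∈ x ∷ y ∷ [] → u ∈ z ∷ S → u ∈ x ∷ y ∷ S
  endpoint-∈ (here refl)         (here refl) = here refl
  endpoint-∈ (there (here refl)) (here refl) = there (here refl)
  endpoint-∈ _                   (there u∈S) = there (there u∈S)

  endpoint-avoided : ∀ {z v u} → z ∈ x ∷ y ∷ [] → T (chosen v u) → col G v u ≢ col G v z
  endpoint-avoided (here refl)         = chosen-avoids-x
  endpoint-avoided (there (here refl)) = chosen-avoids-y

  admissible-unique : ∀ {S} → Admissible S → Unique S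
  admissible-unique []                  = []
  admissible-unique ((cand , _) ∷ adm) =
    All.map (adj⇒≢ ∘ chosen⇒adj) (candidate⇒chosen-by cand) ∷ admissible-unique adm

  module Endpoint (z : Fin n) (z∈xy : z ∈ x ∷ y ∷ []) where

    chosen-by-z : ∀ {S} → Admissible S → All (λ s → T (chosen z s)) S
    chosen-by-z []                  = []
    chosen-by-z {_ ∷ S} ((cand , _) ∷ adm) = candidate⇒chosen {S} (endpoint-∈ z∈xy (here refl)) cand ∷ chosen-by-z adm

    split : ∀ {w S u} → u ∈ z ∷ w ∷ S → u ≡ w ⊎ u ∈ z ∷ S
    split (here refl)         = inj₂ (here refl)
    split (there (here refl)) = inj₁ refl
    split (there (there u∈S)) = inj₂ (there u∈S)

    colour-injective-at : ∀ {w S} → Admissible (w ∷ S) → ∀ {a b} → a ∈ z ∷ S → b ∈ z ∷ S →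
                          col G w a ≡ col G w b → a ≡ b
    colour-injective-at _                (here refl) (here refl) _ = refl
    colour-injective-at ((cand , _) ∷ _) (here refl) (there b∈S) wz≡wb =
      ⊥-elim (endpoint-avoided z∈xy (All.lookup (candidate⇒chosen-by cand) b∈S) (sym wz≡wb))
    colour-injective-at ((cand , _) ∷ _) (there a∈S) (here refl) wa≡wz =
      ⊥-elim (endpoint-avoided z∈xy (All.lookup (candidate⇒chosen-by cand) a∈S) wa≡wz)
    colour-injective-at ((cand , _) ∷ _) (there a∈S) (there b∈S) wa≡wb =
      chosen-colour-injective (All.lookup (candidate⇒chosen-by cand) a∈S) (All.lookup (candidate⇒chosen-by cand) b∈S) wa≡wb

    fresh : ∀ {w S} → Admissible (w ∷ S) → ∀ {u a b} → u ∈ z ∷ S → a ∈ z ∷ S → b ∈ z ∷ S →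
            col G u w ≢ col G a b
    fresh ((_ , no-clash) ∷ _) u∈ a∈ b∈ uw≡ab =
      no-clash (clashes⁺ (endpoint-∈ z∈xy u∈) (endpoint-∈ z∈xy a∈) (endpoint-∈ z∈xy b∈) uw≡ab)

    rainbow : ∀ {S} → Admissible S → IsRainbow (z ∷ S)
    rainbow [] (here refl) (here refl) _ _ u≢v _ _ = ⊥-elim (u≢v refl)
    rainbow {w ∷ S} adm@(_ ∷ adm′) u∈ v∈ u′∈ v′∈ u≢v u′≢v′ uv≡u′v′
      with split u∈ | split v∈ | split u′∈ | split v′∈
    ... | inj₁ refl | inj₁ refl | _         | _         = ⊥-elim (u≢v refl)
    ... | _         | _         | inj₁ refl | inj₁ refl = ⊥-elim (u′≢v′ refl)
    ... | inj₁ refl | inj₂ v∈₀  | inj₁ refl | inj₂ v′∈₀ = inj₁ (refl , colour-injective-at adm v∈₀ v′∈₀ uv≡u′v′)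
    ... | inj₁ refl | inj₂ v∈₀  | inj₂ u′∈₀ | inj₁ refl =
      inj₂ (refl , colour-injective-at adm v∈₀ u′∈₀ (trans uv≡u′v′ (col-sym G _ w)))
    ... | inj₁ refl | inj₂ v∈₀  | inj₂ u′∈₀ | inj₂ v′∈₀ = ⊥-elim (fresh adm v∈₀ u′∈₀ v′∈₀ (trans (col-sym G _ w) uv≡u′v′))
    ... | inj₂ u∈₀  | inj₁ refl | inj₁ refl | inj₂ v′∈₀ =
      inj₂ (colour-injective-at adm u∈₀ v′∈₀ (trans (col-sym G w _) uv≡u′v′) , refl)
    ... | inj₂ u∈₀  | inj₁ refl | inj₂ u′∈₀ | inj₁ refl =
      inj₁ (colour-injective-at adm u∈₀ u′∈₀ (trans (col-sym G w _) (trans uv≡u′v′ (col-sym G _ w))) , refl)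
    ... | inj₂ u∈₀  | inj₁ refl | inj₂ u′∈₀ | inj₂ v′∈₀ = ⊥-elim (fresh adm u∈₀ u′∈₀ v′∈₀ uv≡u′v′)
    ... | inj₂ u∈₀  | inj₂ v∈₀  | inj₁ refl | inj₂ v′∈₀ = ⊥-elim (fresh adm v′∈₀ u∈₀ v∈₀ (trans (col-sym G _ w) (sym uv≡u′v′)))
    ... | inj₂ u∈₀  | inj₂ v∈₀  | inj₂ u′∈₀ | inj₁ refl = ⊥-elim (fresh adm u′∈₀ u∈₀ v∈₀ (sym uv≡u′v′))
    ... | inj₂ u∈₀  | inj₂ v∈₀  | inj₂ u′∈₀ | inj₂ v′∈₀ = rainbow adm′ u∈₀ v∈₀ u′∈₀ v′∈₀ u≢v u′≢v′ uv≡u′v′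

    adjacent-to-last : ∀ {w S} → Admissible (w ∷ S) → ∀ {v} → v ∈ z ∷ S → adj G w v ≡ true
    adjacent-to-last adm@((cand , _) ∷ _) (here refl) = trans (adj-sym G _ z) (chosen⇒adj (All.head (chosen-by-z adm)))
    adjacent-to-last ((cand , _) ∷ _)     (there v∈S) = chosen⇒adj (All.lookup (candidate⇒chosen-by cand) v∈S)

    complete : ∀ {S} → Admissible S → ∀ {u v} → u ∈ z ∷ S → v ∈ z ∷ S → u ≢ v → adj G u v ≡ true
    complete [] (here refl) (here refl) u≢v = ⊥-elim (u≢v refl)
    complete {w ∷ S} adm@(_ ∷ adm′) u∈ v∈ u≢v with split u∈ | split v∈
    ... | inj₁ refl | inj₁ refl = ⊥-elim (u≢v refl)
    ... | inj₁ refl | inj₂ v∈₀  = adjacent-to-last adm v∈₀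
    ... | inj₂ u∈₀  | inj₁ refl = trans (adj-sym G _ w) (adjacent-to-last adm u∈₀)
    ... | inj₂ u∈₀  | inj₂ v∈₀  = complete adm′ u∈₀ v∈₀ u≢v

    z∉ : ∀ {S} → Admissible S → All (z ≢_) S
    z∉ adm = All.map (adj⇒≢ ∘ chosen⇒adj) (chosen-by-z adm)

    rainbowKr : ∀ {S} → Admissible S → RainbowKr G (suc (length S)) (toSubset (z ∷ S))
    rainbowKr {S} adm =
      ∣toSubset∣ (z∉ adm ∷ admissible-unique adm) ,
      (λ u v u∈ v∈ → complete adm (∈-toSubset⁻ (z ∷ S) u∈) (∈-toSubset⁻ (z ∷ S) v∈)) ,
      (λ u v u′ v′ u∈ v∈ u′∈ v′∈ → rainbow adm (∈-toSubset⁻ (z ∷ S) u∈) (∈-toSubset⁻ (z ∷ S) v∈)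
                                              (∈-toSubset⁻ (z ∷ S) u′∈) (∈-toSubset⁻ (z ∷ S) v′∈))

    tiling : ∀ {S} → Admissible S → HasPerfectRainbowTiling G (suc (length S)) (toSubset (z ∷ S))
    tiling adm = (_ ∷ []) , (rainbowKr adm ∷ []) , ([] ∷ []) , λ _ → mk⇔ here λ { (here v∈) → v∈ ; (there ()) }

  admissible⇒connector : ∀ {S} → Admissible S → Connector G (suc (length S)) 1 x y (toSubset S)
  admissible⇒connector {S} adm =
    (λ x∈ → All.lookup (X.z∉ adm) (∈-toSubset⁻ S x∈) refl) ,
    (λ y∈ → All.lookup (Y.z∉ adm) (∈-toSubset⁻ S y∈) refl) ,
    trans (∣toSubset∣ (admissible-unique adm)) (sym (*-identityʳ (length S))) ,
    X.tiling adm , Y.tiling adm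
    where
      module X = Endpoint x (here refl)
      module Y = Endpoint y (there (here refl))

module Fibres {n : ℕ} where

  open import Data.Nat using (_≤_; _^_; _*_; z≤n)
  open import Data.Nat.Properties using (≤-trans; ≤-reflexive)
  import Data.Bool.Properties as Bool
  import Data.Fin.Properties as Fin
  open import Data.Fin.Subset using (Subset) renaming (_∈_ to _∈ₛ_)
  import Data.List.Properties as List
  import Data.Vec.Properties as Vec
  open import Data.List.Membership.Propositional.Properties using (∈-deduplicate⁺)
  open Counting
  open Subsets

  _≟ₛ_ : DecidableEquality (Subset n)
  _≟ₛ_ = Vec.≡-dec Bool._≟_

  length≤K^K*subsets : ∀ K (Ss : List (List (Fin n))) → Unique Ss → (∀ {S} → S ∈ Ss → length S ≡ K) →
                       length Ss ≤ K ^ K * length (deduplicate _≟ₛ_ (map toSubset Ss))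
  length≤K^K*subsets K Ss Ss! length≡K =
    length≤fibre*image _≟ₛ_ toSubset (K ^ K) Ss _ (λ S∈ → ∈-deduplicate⁺ _≟ₛ_ (∈-map⁺ toSubset S∈)) fibre
    where
      inFibre : Subset n → List (Fin n) → Bool
      inFibre X S = isYes (toSubset S ≟ₛ X)
      -- Every sequence with the same set as S₀ is a word of length K over S₀.
      fibre : ∀ X → countᵇ (inFibre X) Ss ≤ K ^ K
      fibre X with filterᵇ (inFibre X) Ss in F≡
      ... | []     = z≤n
      ... | S₀ ∷ F = ≤-trans (unique-⊆⇒length≤ (List.≡-dec Fin._≟_) F! F⊆words)
                             (≤-reflexive (trans (length-words K S₀) (cong (_^ K) (length≡K S₀∈))))
        where
          member : ∀ {S} → S ∈ S₀ ∷ F → S ∈ Ss × T (inFibre X S)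
          member S∈ = ∈-filter⁻ (T? ∘ inFibre X) {xs = Ss} (subst (_ ∈_) (sym F≡) S∈)
          F! : Unique (S₀ ∷ F)
          F! = subst Unique F≡ (filter⁺ (T? ∘ inFibre X) Ss!)
          S₀∈ : S₀ ∈ Ss
          S₀∈ = proj₁ (member (here refl))
          F⊆words : ∀ {S} → S ∈ S₀ ∷ F → S ∈ words K S₀
          F⊆words {S} S∈ =
            let S∈Ss , S↦X = member S∈
                same : toSubset S ≡ toSubset S₀
                same = trans (toWitness S↦X) (sym (toWitness (proj₂ (member (here refl)))))
            in subst (λ m → _ ∈ words m S₀) (length≡K S∈Ss)
                     (∈-words (All.tabulate λ u∈ → ∈-toSubset⁻ S₀ (subst (_ ∈ₛ_) same (∈-toSubset⁺ u∈))))

module ManyConnectors where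

  open import Data.Nat using (ℕ; suc; _+_; _*_; _≤_; _^_)
  open import Data.Nat.Properties using (≤-refl; +-cancelˡ-≤; +-monoˡ-≤; *-monoˡ-≤; *-monoʳ-≤; module ≤-Reasoning)
  open import Data.Nat.Tactic.RingSolver using (solve-∀)
  open import Data.List.Properties using (length-tabulate)
  import Data.List.Relation.Unary.All.Properties as All
  open import Data.List.Relation.Unary.Unique.DecPropositional.Properties using (deduplicate-!)
  open Counting
  open Subsets
  open Fibres

  complement-bound : ∀ {Q q n c d m r} → Q * n + c ≤ Q * d + q * n → d ≤ m + 2 → m + r ≡ n →
                     Q * r + c ≤ q * n + 2 * Q
  complement-bound {Q} {q} {n} {c} {d} {m} {r} degree d≤m+2 m+r≡n = +-cancelˡ-≤ (Q * m) _ _ (begin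
    Q * m + (Q * r + c)  ≡⟨ distrib Q m r c ⟩
    Q * (m + r) + c      ≡⟨ cong (λ z → Q * z + c) m+r≡n ⟩
    Q * n + c            ≤⟨ degree ⟩
    Q * d + q * n        ≤⟨ +-monoˡ-≤ (q * n) (*-monoʳ-≤ Q d≤m+2) ⟩
    Q * (m + 2) + q * n  ≡⟨ undistrib Q m q n ⟩
    Q * m + (q * n + 2 * Q) ∎)
    where
      open ≤-Reasoning
      distrib : ∀ Q m x c → Q * m + (Q * x + c) ≡ Q * (m + x) + c
      distrib = solve-∀
      undistrib : ∀ Q m q n → Q * (m + 2) + q * n ≡ Q * m + (q * n + 2 * Q)
      undistrib = solve-∀

  many-connectors : ∀ k q {n} (G : ECGraph n) (x y : Fin n) → suc k ≤ q → 4 * q * q * suc (suc k) ^ 3 ≤ n →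
    (∀ v → 2 * suc k * q * n + 2 * suc k * n ≤ 2 * suc k * q * colourDeg G v + q * n) →
    ∃ λ L → Unique L × All (Connector G (suc (suc k)) 1 x y) L ×
            n ^ suc k ≤ length L * (suc k ^ suc k * (4 * q * q) ^ suc k)
  many-connectors k q {n} G x y K≤q n-large degree = L , deduplicate-! _≟ₛ_ _ , connectors , (begin
    n ^ K                                ≤⟨ many-sequences K ≤-refl ⟩
    length Ss * P ^ K                    ≤⟨ *-monoˡ-≤ (P ^ K) Ss≤ ⟩
    K ^ K * length L * P ^ K             ≡⟨ regroup (K ^ K) (length L) (P ^ K) ⟩
    length L * (K ^ K * P ^ K)           ∎)
    where
      open ≤-Reasoning
      ρ = RainbowNeighbourhoods.rainbowChoice G x y
      open Greedy ρ
      open Connectors ρ using (admissible⇒connector)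
      missing-bound : ∀ v → 2 * suc k * q * missing v + 2 * suc k * n ≤ q * n + 2 * (2 * suc k * q)
      missing-bound v =
        complement-bound {2 * suc k * q} {q} {n} (degree v) (RainbowNeighbourhoods.colourDeg≤chosen+2 G x y v)
                         (trans (countᵇ+countᵇ-not (RainbowChoice.chosen ρ v) (allFin n)) (length-tabulate id))
      open Analysis k q K≤q n-large missing-bound
      Ss = sequences K
      L = deduplicate _≟ₛ_ (map toSubset Ss)
      Ss≤ : length Ss ≤ K ^ K * length L
      Ss≤ = length≤K^K*subsets K Ss (sequences-unique K) (∈-sequences⇒length K)
      connectors : All (Connector G (suc K) 1 x y) L
      connectors = All.deduplicate⁺ _≟ₛ_ (All.map⁺ (All.tabulate λ {S} S∈ →
        subst (λ m → Connector G (suc m) 1 x y (toSubset S)) (∈-sequences⇒length K S∈)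
              (admissible⇒connector (∈-sequences⇒admissible K S∈))))
      regroup : ∀ a l p → a * l * p ≡ l * (a * p)
      regroup = solve-∀

open import Data.Nat using (suc; _≤_; z≤n; s≤s)
import Data.Nat as ℕ
import Data.Nat.Properties as ℕ
open import Data.Rational using (ℚ; 0ℚ; 1ℚ; _+_; _-_; _*_; _<_) renaming (_≤_ to _≤ℚ_)
open import Data.Integer using (+_)
open import Data.Rational using (_/_)
import Data.Rational.Properties as ℚ
open Rationals using (archimedean; 1/suc-pos; 1/suc-antimono; clear-denominators; ≤-1/suc-scale)
open ManyConnectors using (many-connectors)

proposition4p2 : ∀ (r : ℕ) → 2 ≤ r → ∀ (ε : ℚ) → 0ℚ < ε →
    ∃ λ (η₀ : ℚ) → 0ℚ < η₀ ×
      (∀ (η : ℚ) → 0ℚ < η → η ≤ℚ η₀ →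
        ∃ λ (n₀ : ℕ) → ∀ (n : ℕ) → n₀ ≤ n → (G : ECGraph n) →
          minColourDeg≥ G ((1ℚ - inv2rm1 r + ε) * (+ n / 1)) →
          Closed G r 1 η)
proposition4p2 (suc (suc k)) (s≤s (s≤s z≤n)) ε 0<ε =
  + 1 / suc D , 1/suc-pos D , λ η _ η≤η₀ → P ℕ.* suc K ℕ.^ 3 , λ n n₀≤n G δ x y →
    let L , L! , connectors , count = many-connectors k q G x y K≤q n₀≤n (degree G δ)
    in L , L! , connectors , close {n = n} {L = length L} η≤η₀ count
  where
    -- suc a = 2K, so + 1 / suc a is inv2rm1 r, and q = 2K (d + 1), so + 1 / q ≤ + 1 / suc d ≤ ε.
    K = suc k
    d = proj₁ (archimedean ε 0<ε)
    a = k ℕ.+ 1 ℕ.* suc k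
    q′ = d ℕ.+ a ℕ.* suc d
    q = suc q′
    P = 4 ℕ.* q ℕ.* q
    D = K ℕ.^ K ℕ.* P ℕ.^ K
    K≤q : K ≤ q
    K≤q = ℕ.≤-trans (ℕ.m≤n*m K 2) (ℕ.m≤m*n (2 ℕ.* K) (suc d))
    1/q≤ε : + 1 / q ≤ℚ ε
    1/q≤ε = ℚ.≤-trans (1/suc-antimono (ℕ.m≤m+n d _)) (proj₂ (archimedean ε 0<ε))
    degree : ∀ {n} (G : ECGraph n) → minColourDeg≥ G ((1ℚ - inv2rm1 (suc K) + ε) * (+ n / 1)) →
             ∀ v → 2 ℕ.* K ℕ.* q ℕ.* n ℕ.+ 2 ℕ.* K ℕ.* n ≤ 2 ℕ.* K ℕ.* q ℕ.* colourDeg G v ℕ.+ q ℕ.* n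
    degree {n} G δ v = clear-denominators a q′ ε 1/q≤ε n (colourDeg G v) (δ v)
    close : ∀ {η n L} → η ≤ℚ + 1 / suc D → n ℕ.^ K ≤ L ℕ.* D → η * (+ (n ℕ.^ (suc K ℕ.* 1 ℕ.∸ 1)) / 1) ≤ℚ + L / 1
    close {η} {n} {L} η≤ n^K≤ = subst (λ e → η * (+ (n ℕ.^ e) / 1) ≤ℚ + L / 1) (sym (ℕ.*-identityʳ K))
                                      (≤-1/suc-scale η D η≤ (n ℕ.^ K) L (ℕ.≤-trans n^K≤ (ℕ.*-monoʳ-≤ L (ℕ.n≤1+n D))))
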